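{- Let $G$ be a finite simple graph in which every vertex is contained in a cycle, and let $g=\mathrm{girth}(G)$ (length of a shortest cycle). Then $i_{cy}(G)=g-1$ if and only if $G$ contains a path on $g-1$ vertices such that every vertex not on the path is adjacent to both endpoints of the path and to no other vertex of the path.
   Context: For $S\subseteq V$, $\langle S\rangle$ is the induced subgraph. $S$ is cycle independent if $\langle S\rangle$ is acyclic; $i_{cy}(G)$ is the minimum size of an inclusion-maximal cycle independent set. -}

module Defs where

open import Data.Nat using (ℕ; _≤_; _∸_)
open import Data.Fin using (Fin)
open import Data.Fin.Subset using (Subset; _∈_; _⊆_; ∣_∣)
open import Data.List using (List; []; _∷_; _++_; [_]; length)
open import Data.List.Relation.Unary.All using (All)
open import Data.List.Relation.Unary.Unique.Propositional using (Unique)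
open import Data.List.Relation.Unary.Linked using (Linked)
import Data.List.Membership.Propositional as LM
open import Data.Product using (Σ; ∃; _×_)
open import Relation.Nullary using (¬_)
open import Relation.Binary.PropositionalEquality using (_≡_)
open import Relation.Binary using (Decidable)

record Graph (n : ℕ) : Set₁ where
  field
    Adj    : Fin n → Fin n → Set
    adj?   : Decidable Adj
    sym    : ∀ {u v} → Adj u v → Adj v u
    irrefl : ∀ {v} → ¬ Adj v v

module _ {n : ℕ} (G : Graph n) where
  open Graph G

  IsPath : List (Fin n) → Set
  IsPath xs = Unique xs × Linked Adj xs

  IsCycle : List (Fin n) → Set
  IsCycle [] = Data.Empty.⊥ where import Data.Empty
  IsCycle (x ∷ xs) = (3 ≤ length (x ∷ xs)) × Unique (x ∷ xs) × Linked Adj ((x ∷ xs) ++ [ x ])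

  EveryVertexOnCycle : Set
  EveryVertexOnCycle = ∀ v → ∃ λ c → IsCycle c × v LM.∈ c

  IsGirth : ℕ → Set
  IsGirth g = (∃ λ c → IsCycle c × length c ≡ g) × (∀ c → IsCycle c → g ≤ length c)

  -- S is cycle independent: the induced subgraph ⟨S⟩ is acyclic, i.e.
  -- no cycle of G has all its vertices in S.
  CycleIndependent : Subset n → Set
  CycleIndependent S = ∀ c → IsCycle c → ¬ All (_∈ S) c

  MaximalCycleIndependent : Subset n → Set
  MaximalCycleIndependent S =
    CycleIndependent S × (∀ T → S ⊆ T → CycleIndependent T → T ⊆ S)

  IsICy : ℕ → Set
  IsICy m = (∃ λ S → MaximalCycleIndependent S × ∣ S ∣ ≡ m)
          × (∀ S → MaximalCycleIndependent S → m ≤ ∣ S ∣)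

  HasSpecialPath : ℕ → Set
  HasSpecialPath k =
    Σ (Fin n) λ a → Σ (List (Fin n)) λ mid → Σ (Fin n) λ b →
      IsPath (a ∷ mid ++ [ b ]) × length (a ∷ mid ++ [ b ]) ≡ k ×
      (∀ v → ¬ (v LM.∈ (a ∷ mid ++ [ b ])) →
         Adj v a × Adj v b × (∀ w → w LM.∈ mid → ¬ Adj v w))

-- Write g = h + 1. Every set of at most h vertices is cycle independent, since a cycle
-- needs at least g distinct vertices; hence a maximal cycle independent set S has at
-- least h elements, and i_cy(G) = h means that some maximal S has exactly h. For such
-- an S and any w ∉ S, the set S ∪ {w} contains a cycle, necessarily of length g and
-- through w, so S is the vertex set of a path whose endpoints are both adjacent to w.
-- Fixing one such path, every outside vertex w has two distinct neighbours on it; if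
-- they were not the two endpoints, they would close a cycle of length < g with w.
-- Conversely, the vertices of a special path form a cycle independent set of size h,
-- and it is maximal because every outside vertex closes the path into a cycle.
module Submission where

open import Defs
open import Data.Nat using (ℕ; _∸_)
open import Function.Bundles using (_⇔_)

open import Level using (Level)
open import Function.Base using (_∘_)
open import Function.Bundles using (mk⇔)
open import Data.Nat using (zero; suc; _+_; _≤_; _<_; s≤s; z≤n; _≤?_)
open import Data.Nat.Properties
  using (≤-trans; ≤-reflexive; ≤-antisym; +-comm; +-identityʳ; +-cancelˡ-≤; +-monoʳ-≤;
         +-suc; n≤1+n; n≤0⇒n≡0; ≤-pred; suc-injective; <⇒≤; ≰⇒>; ≤⇒≯; <-irrefl;
         module ≤-Reasoning)
open import Data.Vec using ([]; _∷_)
open import Data.Fin using (Fin; _≟_)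
open import Data.Fin.Properties using (any?)
open import Data.Fin.Subset using (Subset; _∈_; _∉_; _⊆_; ∣_∣; _∪_; ⁅_⁆; _-_; ⊥; inside; outside)
open import Data.Fin.Subset.Properties
  using (_∈?_; x∈p∧x≢y⇒x∈p-y; x∈p⇒∣p-x∣<∣p∣; x∈p∪q⁻; x∈p∪q⁺; x∈⁅x⁆; x∈⁅y⁆⇒x≡y;
         ∣⁅x⁆∣≡1; ∣⊥∣≡0; p⊆p∪q)
open import Data.List using (List; []; _∷_; _++_; [_]; _∷ʳ_; length)
open import Data.List.Properties
  using (length-++; length-++-≤ʳ; ++-assoc; ++-identityʳ; ++-conicalˡ; ++-conicalʳ;
         ∷-injective; ∷ʳ-injective)
open import Data.List.Relation.Unary.All as All using (All; []; _∷_)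
open import Data.List.Relation.Unary.All.Properties using (¬Any⇒All¬; All¬⇒¬Any; ¬All⇒Any¬)
  renaming (++⁻ˡ to All-++⁻ˡ)
open import Data.List.Relation.Unary.Any using (here; there; satisfied)
open import Data.List.Relation.Unary.AllPairs as AllPairs using (AllPairs; []; _∷_; allPairs?)
open import Data.List.Relation.Unary.Unique.Propositional using (Unique)
import Data.List.Relation.Unary.Unique.Propositional.Properties as Unique
open import Data.List.Relation.Unary.Linked as Linked using (Linked; []; [-]; _∷_; linked?)
open import Data.List.Relation.Binary.Permutation.Propositional using (_↭_)
open import Data.List.Relation.Binary.Permutation.Propositional.Properties
  using (↭-length; shifts; ++-comm; All-resp-↭)
open import Data.List.Reverse using (reverseView; []; _∶_∶ʳ_)
import Data.List.Membership.Propositional as List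
open import Data.List.Membership.Propositional.Properties using (∈-∃++; ∈-++⁺ˡ; ∈-++⁺ʳ)
import Data.List.Membership.DecPropositional as DecMembership
open import Data.Product using (∃; ∃-syntax; _×_; _,_; proj₁; proj₂)
import Data.Product as Product
open import Data.Sum using (_⊎_; inj₁; inj₂)
import Data.Sum as Sum
open import Relation.Nullary using (¬_; Dec; yes; no; ¬?; contradiction)
open import Relation.Nullary.Decidable using (_×-dec_)
open import Relation.Binary.Core using (Rel)
open import Relation.Binary.PropositionalEquality
  using (_≡_; _≢_; refl; sym; trans; cong; subst; ≢-sym)

private
  variable
    a ℓ : Level
    A : Set a
    R : Rel A ℓ
    x y z : A
    xs ys : List A

length-∷ʳ : ∀ (xs : List A) x → length (xs ∷ʳ x) ≡ suc (length xs)
length-∷ʳ xs x = trans (length-++ xs) (+-comm (length xs) 1)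

empty-of-length≡0 : ∀ (xs : List A) → length xs ≡ 0 → xs ≡ []
empty-of-length≡0 [] _ = refl

Linked-++⁻ˡ : ∀ xs → Linked R (xs ++ ys) → Linked R xs
Linked-++⁻ˡ []           _        = []
Linked-++⁻ˡ (x ∷ [])     _        = [-]
Linked-++⁻ˡ (x ∷ y ∷ xs) (r ∷ rs) = r ∷ Linked-++⁻ˡ (y ∷ xs) rs

Linked-++⁻ʳ : ∀ xs → Linked R (xs ++ ys) → Linked R ys
Linked-++⁻ʳ []       rs = rs
Linked-++⁻ʳ (x ∷ xs) rs = Linked-++⁻ʳ xs (Linked.tail rs)

Linked-∷ʳ⁺ : ∀ xs → Linked R (xs ∷ʳ y) → R y z → Linked R (xs ∷ʳ y ∷ʳ z)
Linked-∷ʳ⁺ []            _          r = r ∷ [-]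
Linked-∷ʳ⁺ (x ∷ [])      (r′ ∷ [-]) r = r′ ∷ r ∷ [-]
Linked-∷ʳ⁺ (x ∷ x′ ∷ xs) (r′ ∷ rs)  r = r′ ∷ Linked-∷ʳ⁺ (x′ ∷ xs) rs r

Linked-∷ʳ⁻ : ∀ xs → Linked R (xs ∷ʳ y ∷ʳ z) → R y z
Linked-∷ʳ⁻ []       (r ∷ _) = r
Linked-∷ʳ⁻ (x ∷ xs) rs      = Linked-∷ʳ⁻ xs (Linked.tail rs)

AllPairs-++⁻ˡ : ∀ xs → AllPairs R (xs ++ ys) → AllPairs R xs
AllPairs-++⁻ˡ []       _        = []
AllPairs-++⁻ˡ (x ∷ xs) (r ∷ rs) = All-++⁻ˡ xs r ∷ AllPairs-++⁻ˡ xs rs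

AllPairs-++⁻ʳ : ∀ xs → AllPairs R (xs ++ ys) → AllPairs R ys
AllPairs-++⁻ʳ []       rs       = rs
AllPairs-++⁻ʳ (x ∷ xs) (_ ∷ rs) = AllPairs-++⁻ʳ xs rs

AllPairs-∷ʳ⁻ : ∀ xs → AllPairs R (xs ∷ʳ y) → All (λ x → R x y) xs
AllPairs-∷ʳ⁻ []       _        = []
AllPairs-∷ʳ⁻ (x ∷ xs) (r ∷ rs) = All.lookup r (∈-++⁺ʳ xs (here refl)) ∷ AllPairs-∷ʳ⁻ xs rs

inner≢ends : ∀ {a b : A} xs → Unique (a ∷ xs ∷ʳ b) → x List.∈ xs → x ≢ a × x ≢ b
inner≢ends xs (a≢ ∷ u) x∈xs =
  ≢-sym (All.lookup a≢ (∈-++⁺ˡ x∈xs)) , All.lookup (AllPairs-∷ʳ⁻ xs u) x∈xs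

Precedes : A → A → List A → Set _
Precedes x y xs = ∃[ pre ] ∃[ s ] ∃[ post ] xs ≡ pre ++ (x ∷ s ∷ʳ y) ++ post

Ends : A → A → List A → Set _
Ends x y xs = ∃[ s ] xs ≡ x ∷ s ∷ʳ y

∈-∈⇒Precedes : x List.∈ xs → y List.∈ xs → x ≢ y → Precedes x y xs ⊎ Precedes y x xs
∈-∈⇒Precedes (here refl) (here refl) x≢y = contradiction refl x≢y
∈-∈⇒Precedes {x = x} (here refl) (there y∈xs) _ with ∈-∃++ y∈xs
... | s , post , refl = inj₁ ([] , s , post , cong (x ∷_) (sym (++-assoc s _ post)))
∈-∈⇒Precedes {y = y} (there x∈xs) (here refl) _ with ∈-∃++ x∈xs
... | s , post , refl = inj₂ ([] , s , post , cong (y ∷_) (sym (++-assoc s _ post)))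
∈-∈⇒Precedes {xs = z ∷ _} (there x∈xs) (there y∈xs) x≢y =
  Sum.map cons cons (∈-∈⇒Precedes x∈xs y∈xs x≢y)
  where
  cons : Precedes x y xs → Precedes x y (z ∷ xs)
  cons (pre , s , post , eq) = z ∷ pre , s , post , cong (z ∷_) eq

Ends⇒≡ : ∀ {a b : A} xs → Ends x y (a ∷ xs ∷ʳ b) → x ≡ a × y ≡ b
Ends⇒≡ xs (s , eq) with ∷-injective eq
... | a≡x , eq′ = sym a≡x , sym (proj₂ (∷ʳ-injective xs s eq′))

∃-ofLength? : ∀ {m p} {P : List (Fin m) → Set p} → (∀ xs → Dec (P xs)) →
              ∀ k → Dec (∃ λ xs → length xs ≡ k × P xs)
∃-ofLength? P? zero with P? []
... | yes P[] = yes ([] , refl , P[])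
... | no ¬P[] = no λ { ([] , _ , P[]) → ¬P[] P[] }
∃-ofLength? P? (suc k) with any? (λ x → ∃-ofLength? (P? ∘ (x ∷_)) k)
... | yes (x , xs , len , Pxs) = yes (x ∷ xs , cong suc len , Pxs)
... | no none = no λ { (x ∷ xs , len , Pxs) → none (x , xs , suc-injective len , Pxs) }

∣p∪q∣≤∣p∣+∣q∣ : ∀ {m} (p q : Subset m) → ∣ p ∪ q ∣ ≤ ∣ p ∣ + ∣ q ∣
∣p∪q∣≤∣p∣+∣q∣ []            []            = z≤n
∣p∪q∣≤∣p∣+∣q∣ (outside ∷ p) (outside ∷ q) = ∣p∪q∣≤∣p∣+∣q∣ p q
∣p∪q∣≤∣p∣+∣q∣ (outside ∷ p) (inside ∷ q)  =
  ≤-trans (s≤s (∣p∪q∣≤∣p∣+∣q∣ p q)) (≤-reflexive (sym (+-suc ∣ p ∣ ∣ q ∣)))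
∣p∪q∣≤∣p∣+∣q∣ (inside ∷ p)  (outside ∷ q) = s≤s (∣p∪q∣≤∣p∣+∣q∣ p q)
∣p∪q∣≤∣p∣+∣q∣ (inside ∷ p)  (inside ∷ q)  =
  s≤s (≤-trans (∣p∪q∣≤∣p∣+∣q∣ p q) (+-monoʳ-≤ ∣ p ∣ (n≤1+n ∣ q ∣)))

module _ {m : ℕ} where

  ∣p∪⁅x⁆∣≤1+∣p∣ : ∀ (p : Subset m) x → ∣ p ∪ ⁅ x ⁆ ∣ ≤ suc ∣ p ∣
  ∣p∪⁅x⁆∣≤1+∣p∣ p x = ≤-trans (∣p∪q∣≤∣p∣+∣q∣ p ⁅ x ⁆)
    (≤-reflexive (trans (cong (∣ p ∣ +_) (∣⁅x⁆∣≡1 x)) (+-comm ∣ p ∣ 1)))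

  x∈p∪⁅x⁆ : ∀ (p : Subset m) x → x ∈ p ∪ ⁅ x ⁆
  x∈p∪⁅x⁆ p x = x∈p∪q⁺ (inj₂ (x∈⁅x⁆ x))

  All∈p∪⁅x⁆⇒All∈p : ∀ {p x} {xs : List (Fin m)} →
                    All (x ≢_) xs → All (_∈ p ∪ ⁅ x ⁆) xs → All (_∈ p) xs
  All∈p∪⁅x⁆⇒All∈p {p} {x} x≢xs xs⊆p∪x = All.zipWith in-p (x≢xs , xs⊆p∪x)
    where
    in-p : ∀ {y} → x ≢ y × y ∈ p ∪ ⁅ x ⁆ → y ∈ p
    in-p (x≢y , y∈) with x∈p∪q⁻ p ⁅ x ⁆ y∈
    ... | inj₁ y∈p = y∈p
    ... | inj₂ y∈x = contradiction (sym (x∈⁅y⁆⇒x≡y x y∈x)) x≢y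

  length≤∣∣ : ∀ {p : Subset m} {xs} → Unique xs → All (_∈ p) xs → length xs ≤ ∣ p ∣
  length≤∣∣ {p} {[]}     _        _             = z≤n
  length≤∣∣ {p} {x ∷ xs} (x≢ ∷ u) (x∈p ∷ xs⊆p) =
    ≤-trans (s≤s (length≤∣∣ u (All.zipWith in-p-x (x≢ , xs⊆p)))) (x∈p⇒∣p-x∣<∣p∣ x∈p)
    where
    in-p-x : ∀ {y} → x ≢ y × y ∈ p → y ∈ p - x
    in-p-x (x≢y , y∈p) = x∈p∧x≢y⇒x∈p-y y∈p (≢-sym x≢y)

  ∣∣<length⇒∃∉ : ∀ {p : Subset m} {xs} → Unique xs → ∣ p ∣ < length xs → ∃ (_∉ p)
  ∣∣<length⇒∃∉ {p} {xs} u ∣p∣<len with All.all? (_∈? p) xs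
  ... | yes xs⊆p = contradiction ∣p∣<len (≤⇒≯ (length≤∣∣ u xs⊆p))
  ... | no  xs⊈p = satisfied (¬All⇒Any¬ (_∈? p) xs xs⊈p)

  length≡∣∣⇒∈ : ∀ {p : Subset m} {xs} → Unique xs → All (_∈ p) xs → length xs ≡ ∣ p ∣ →
                ∀ {x} → x ∈ p → x List.∈ xs
  length≡∣∣⇒∈ {p} {xs} u xs⊆p len {x} x∈p with DecMembership._∈?_ _≟_ x xs
  ... | yes x∈xs = x∈xs
  ... | no  x∉xs = contradiction (length≤∣∣ (¬Any⇒All¬ xs x∉xs ∷ u) (x∈p ∷ xs⊆p)) (<-irrefl len)

  fromList : List (Fin m) → Subset m
  fromList []       = ⊥
  fromList (x ∷ xs) = fromList xs ∪ ⁅ x ⁆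

  ∈-fromList : ∀ {x} xs → x List.∈ xs → x ∈ fromList xs
  ∈-fromList (x ∷ xs) (here refl)  = x∈p∪⁅x⁆ (fromList xs) x
  ∈-fromList (_ ∷ xs) (there x∈xs) = x∈p∪q⁺ (inj₁ (∈-fromList xs x∈xs))

  ∣fromList∣≤length : ∀ xs → ∣ fromList xs ∣ ≤ length xs
  ∣fromList∣≤length []       = ≤-reflexive (∣⊥∣≡0 m)
  ∣fromList∣≤length (x ∷ xs) =
    ≤-trans (∣p∪⁅x⁆∣≤1+∣p∣ (fromList xs) x) (s≤s (∣fromList∣≤length xs))

module _ {n : ℕ} (G : Graph n) where
  open Graph G renaming (sym to Adj-sym)

  IsCycle? : ∀ c → Dec (IsCycle G c)
  IsCycle? []       = no λ ()
  IsCycle? (x ∷ xs) = (3 ≤? length (x ∷ xs))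
                ×-dec allPairs? (λ u v → ¬? (u ≟ v)) (x ∷ xs)
                ×-dec linked? adj? (x ∷ xs ∷ʳ x)

  IsCycle⇒3≤length : ∀ c → IsCycle G c → 3 ≤ length c
  IsCycle⇒3≤length (_ ∷ _) (3≤len , _) = 3≤len

  IsCycle⇒Unique : ∀ c → IsCycle G c → Unique c
  IsCycle⇒Unique (_ ∷ _) (_ , u , _) = u

  IsPath-infix : ∀ pre {seg post} → IsPath G (pre ++ seg ++ post) → IsPath G seg
  IsPath-infix pre {seg} (u , l) =
    AllPairs-++⁻ˡ seg (AllPairs-++⁻ʳ pre u) , Linked-++⁻ˡ seg (Linked-++⁻ʳ pre l)

  IsCycle-rotate₁ : ∀ {x} xs → IsCycle G (x ∷ xs) → IsCycle G (xs ∷ʳ x)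
  IsCycle-rotate₁ []       (s≤s () , _)
  IsCycle-rotate₁ {x} (y ∷ ys) (3≤len , (x≢ ∷ u) , (xy ∷ l)) =
      subst (3 ≤_) (cong suc (sym (length-∷ʳ ys x))) 3≤len
    , Unique.++⁺ u ([] ∷ []) (λ { (x∈ , here refl) → All.lookup x≢ x∈ refl })
    , Linked-∷ʳ⁺ (y ∷ ys) l xy

  IsCycle-rotate : ∀ xs {y ys} → IsCycle G (xs ++ y ∷ ys) → IsCycle G (y ∷ ys ++ xs)
  IsCycle-rotate [] {y} {ys} cyc = subst (IsCycle G) (cong (y ∷_) (sym (++-identityʳ ys))) cyc
  IsCycle-rotate (x ∷ xs) {y} {ys} cyc =
    subst (IsCycle G) (cong (y ∷_) (++-assoc ys [ x ] xs)) (IsCycle-rotate xs x-moved-last)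
    where
    x-moved-last : IsCycle G (xs ++ y ∷ ys ∷ʳ x)
    x-moved-last = subst (IsCycle G) (++-assoc xs (y ∷ ys) [ x ]) (IsCycle-rotate₁ (xs ++ y ∷ ys) cyc)

  data OpenCycle (w : Fin n) : List (Fin n) → Set where
    openCycle : ∀ {x s y} → IsPath G (x ∷ s ∷ʳ y) → ¬ (w List.∈ (x ∷ s ∷ʳ y)) →
                Adj w x → Adj w y → OpenCycle w (x ∷ s ∷ʳ y)

  OpenCycle⇒IsCycle : ∀ {w q} → OpenCycle w q → IsCycle G (w ∷ q)
  OpenCycle⇒IsCycle (openCycle {x} {s} {y} (u , l) w∉ wx wy) =
      s≤s (s≤s (length-++-≤ʳ [ y ] {s}))
    , ¬Any⇒All¬ _ w∉ ∷ u
    , wx ∷ Linked-∷ʳ⁺ (x ∷ s) l (Adj-sym wy)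

  IsCycle⇒OpenCycle : ∀ {w} q → IsCycle G (w ∷ q) → OpenCycle w q
  IsCycle⇒OpenCycle q cyc with reverseView q
  IsCycle⇒OpenCycle .[] (s≤s () , _) | []
  IsCycle⇒OpenCycle .([] ∷ʳ y) (s≤s (s≤s ()) , _) | [] ∶ _ ∶ʳ y
  IsCycle⇒OpenCycle .(x ∷ s ∷ʳ y) (_ , (w≢ ∷ u) , (wx ∷ l)) | (x ∷ s) ∶ _ ∶ʳ y =
    openCycle (u , Linked-++⁻ˡ (x ∷ s ∷ʳ y) l) (All¬⇒¬Any w≢) wx (Adj-sym (Linked-∷ʳ⁻ (x ∷ s) l))

  maximal⇒¬CycleIndependent-∪⁅⁆ : ∀ {S w} → MaximalCycleIndependent G S → w ∉ S →
                                 ¬ CycleIndependent G (S ∪ ⁅ w ⁆)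
  maximal⇒¬CycleIndependent-∪⁅⁆ {S} {w} (_ , maximal) w∉S S∪w-independent =
    w∉S (maximal (S ∪ ⁅ w ⁆) (p⊆p∪q ⁅ w ⁆) S∪w-independent (x∈p∪⁅x⁆ S w))

module Girth {n : ℕ} (G : Graph n) {h : ℕ} (girth : IsGirth G (suc h)) where
  open Graph G using (Adj)

  girth≤length : ∀ c → IsCycle G c → suc h ≤ length c
  girth≤length = proj₂ girth

  small⇒CycleIndependent : ∀ T → ∣ T ∣ ≤ h → CycleIndependent G T
  small⇒CycleIndependent T ∣T∣≤h c cyc c⊆T =
    ≤⇒≯ ∣T∣≤h (≤-trans (girth≤length c cyc) (length≤∣∣ (IsCycle⇒Unique G c cyc) c⊆T))

  small⇒∃∉ : ∀ S → ∣ S ∣ ≤ h → ∃ (_∉ S)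
  small⇒∃∉ S ∣S∣≤h with proj₁ girth
  ... | c , cyc , len =
    ∣∣<length⇒∃∉ (IsCycle⇒Unique G c cyc) (subst (∣ S ∣ <_) (sym len) (s≤s ∣S∣≤h))

  maximal⇒h≤∣∣ : ∀ S → MaximalCycleIndependent G S → h ≤ ∣ S ∣
  maximal⇒h≤∣∣ S maxS with h ≤? ∣ S ∣
  ... | yes h≤∣S∣ = h≤∣S∣
  ... | no  h≰∣S∣ with small⇒∃∉ S (<⇒≤ (≰⇒> h≰∣S∣))
  ...   | v , v∉S = contradiction
                      (small⇒CycleIndependent (S ∪ ⁅ v ⁆) (≤-trans (∣p∪⁅x⁆∣≤1+∣p∣ S v) (≰⇒> h≰∣S∣)))
                      (maximal⇒¬CycleIndependent-∪⁅⁆ G maxS v∉S)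

  -- Maximality only yields ¬ CycleIndependent (S ∪ ⁅ w ⁆); deciding the existence of a
  -- girth cycle inside it turns this into an actual cycle.
  maximal⇒girthCycle : ∀ {S w} → MaximalCycleIndependent G S → ∣ S ∣ ≤ h → w ∉ S →
                       ∃ λ c → length c ≡ suc h × IsCycle G c × All (_∈ S ∪ ⁅ w ⁆) c
  maximal⇒girthCycle {S} {w} maxS ∣S∣≤h w∉S
    with ∃-ofLength? (λ c → IsCycle? G c ×-dec All.all? (_∈? S ∪ ⁅ w ⁆) c) (suc h)
  ... | yes found = found
  ... | no  none  = contradiction S∪w-independent (maximal⇒¬CycleIndependent-∪⁅⁆ G maxS w∉S)
    where
    S∪w-independent : CycleIndependent G (S ∪ ⁅ w ⁆)
    S∪w-independent c cyc c⊆S∪w = none (c , ≤-antisym length≤1+h (girth≤length c cyc) , cyc , c⊆S∪w)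
      where
      length≤1+h : length c ≤ suc h
      length≤1+h = ≤-trans (length≤∣∣ (IsCycle⇒Unique G c cyc) c⊆S∪w)
                           (≤-trans (∣p∪⁅x⁆∣≤1+∣p∣ S w) (s≤s ∣S∣≤h))

  maximal⇒cycleThrough : ∀ {S w} → MaximalCycleIndependent G S → ∣ S ∣ ≤ h → w ∉ S →
                         ∃ λ q → IsCycle G (w ∷ q) × All (_∈ S) q × length q ≡ h
  maximal⇒cycleThrough {S} {w} maxS ∣S∣≤h w∉S with maximal⇒girthCycle maxS ∣S∣≤h w∉S
  ... | c , len , cyc , c⊆S∪w with DecMembership._∈?_ _≟_ w c
  ...   | no w∉c = contradiction (subst (_≤ ∣ S ∣) len (length≤∣∣ (IsCycle⇒Unique G c cyc) c⊆S))
                                 (≤⇒≯ ∣S∣≤h)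
    where
    c⊆S : All (_∈ S) c
    c⊆S = All∈p∪⁅x⁆⇒All∈p (¬Any⇒All¬ c w∉c) c⊆S∪w
  ...   | yes w∈c with ∈-∃++ w∈c
  ...     | xs , ys , refl =
    ys ++ xs , rotated , rest⊆S , suc-injective (trans (sym (↭-length rotation)) len)
    where
    rotation : xs ++ w ∷ ys ↭ w ∷ ys ++ xs
    rotation = ++-comm xs (w ∷ ys)
    rotated : IsCycle G (w ∷ ys ++ xs)
    rotated = IsCycle-rotate G xs cyc
    rest⊆S : All (_∈ S) (ys ++ xs)
    rest⊆S = All∈p∪⁅x⁆⇒All∈p (AllPairs.head (IsCycle⇒Unique G _ rotated))
                             (All.tail (All-resp-↭ rotation c⊆S∪w))

  -- Closing the segment from x to y through w gives a cycle of length |seg| + 1, which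
  -- the girth forces to be at least |l| + 1.
  outer≡[] : ∀ pre {x s y post w} → let l = pre ++ (x ∷ s ∷ʳ y) ++ post in
             IsPath G l → length l ≡ h → ¬ (w List.∈ l) → Adj w x → Adj w y →
             pre ≡ [] × post ≡ []
  outer≡[] pre {x} {s} {y} {post} {w} path len w∉ wx wy =
    ++-conicalˡ pre post outer-empty , ++-conicalʳ pre post outer-empty
    where
    open ≤-Reasoning
    seg : List (Fin n)
    seg = x ∷ s ∷ʳ y
    closed : IsCycle G (w ∷ seg)
    closed = OpenCycle⇒IsCycle G
               (openCycle (IsPath-infix G pre path) (w∉ ∘ ∈-++⁺ʳ pre ∘ ∈-++⁺ˡ) wx wy)
    seg+outer≤seg : length seg + length (pre ++ post) ≤ length seg + 0
    seg+outer≤seg = begin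
      length seg + length (pre ++ post) ≡⟨ length-++ seg ⟨
      length (seg ++ pre ++ post)       ≡⟨ ↭-length (shifts pre seg) ⟨
      length (pre ++ seg ++ post)       ≡⟨ len ⟩
      h                                 ≤⟨ ≤-pred (girth≤length _ closed) ⟩
      length seg                        ≡⟨ +-identityʳ (length seg) ⟨
      length seg + 0                    ∎
    outer-empty : pre ++ post ≡ []
    outer-empty = empty-of-length≡0 (pre ++ post) (n≤0⇒n≡0 (+-cancelˡ-≤ (length seg) _ 0 seg+outer≤seg))

  Precedes⇒Ends : ∀ {l w x y} → IsPath G l → length l ≡ h → ¬ (w List.∈ l) →
                  Adj w x → Adj w y → Precedes x y l → Ends x y l
  Precedes⇒Ends {x = x} {y} path len w∉ wx wy (pre , s , post , refl)
    with outer≡[] pre {post = post} path len w∉ wx wy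
  ... | refl , refl = s , ++-identityʳ (x ∷ s ∷ʳ y)

  outside⇒seesEnds : ∀ {a mid b w x y} → let p = a ∷ mid ∷ʳ b in
                     IsPath G p → length p ≡ h → ¬ (w List.∈ p) →
                     Adj w x → Adj w y → x ≢ y → x List.∈ p → y List.∈ p →
                     Adj w a × Adj w b × (∀ m → m List.∈ mid → ¬ Adj w m)
  outside⇒seesEnds {a} {mid} {b} {w} {x} {y} path len w∉ wx wy x≢y x∈ y∈ =
    let wa , wb = ends-adjacent (endpoints wx wy x≢y x∈ y∈) in wa , wb , avoids-mid
    where
    endpoints : ∀ {u v} → Adj w u → Adj w v → u ≢ v →
                u List.∈ a ∷ mid ∷ʳ b → v List.∈ a ∷ mid ∷ʳ b →
                (u ≡ a × v ≡ b) ⊎ (u ≡ b × v ≡ a)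
    endpoints wu wv u≢v u∈ v∈ =
      Sum.map (Ends⇒≡ mid ∘ Precedes⇒Ends path len w∉ wu wv)
              (Product.swap ∘ Ends⇒≡ mid ∘ Precedes⇒Ends path len w∉ wv wu)
              (∈-∈⇒Precedes u∈ v∈ u≢v)

    ends-adjacent : (x ≡ a × y ≡ b) ⊎ (x ≡ b × y ≡ a) → Adj w a × Adj w b
    ends-adjacent (inj₁ (x≡a , y≡b)) = subst (Adj w) x≡a wx , subst (Adj w) y≡b wy
    ends-adjacent (inj₂ (x≡b , y≡a)) = subst (Adj w) y≡a wy , subst (Adj w) x≡b wx

    inner-no-endpoint : ∀ {m o} → m List.∈ mid → ¬ ((m ≡ a × o ≡ b) ⊎ (m ≡ b × o ≡ a))
    inner-no-endpoint m∈ (inj₁ (m≡a , _)) = proj₁ (inner≢ends mid (proj₁ path) m∈) m≡a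
    inner-no-endpoint m∈ (inj₂ (m≡b , _)) = proj₂ (inner≢ends mid (proj₁ path) m∈) m≡b

    avoids-mid : ∀ m → m List.∈ mid → ¬ Adj w m
    avoids-mid m m∈ wm with m ≟ x
    ... | yes refl = inner-no-endpoint m∈ (endpoints wm wy x≢y x∈ y∈)
    ... | no  m≢x  = inner-no-endpoint m∈ (endpoints wm wx m≢x (there (∈-++⁺ˡ m∈)) x∈)

  maximal⇒SpecialPath : ∀ {S} → MaximalCycleIndependent G S → ∣ S ∣ ≡ h → HasSpecialPath G h
  maximal⇒SpecialPath {S} maxS ∣S∣≡h with small⇒∃∉ S (≤-reflexive ∣S∣≡h)
  ... | v , v∉S with maximal⇒cycleThrough maxS (≤-reflexive ∣S∣≡h) v∉S
  ...   | q , cyc , q⊆S , len with IsCycle⇒OpenCycle G q cyc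
  ...     | openCycle {a} {mid} {b} path _ _ _ = a , mid , b , path , len , sees-ends
    where
    S⊆q : ∀ {z} → z ∈ S → z List.∈ a ∷ mid ∷ʳ b
    S⊆q = length≡∣∣⇒∈ (proj₁ path) q⊆S (trans len (sym ∣S∣≡h))

    sees-ends : ∀ w → ¬ (w List.∈ a ∷ mid ∷ʳ b) →
                Adj w a × Adj w b × (∀ m → m List.∈ mid → ¬ Adj w m)
    sees-ends w w∉q with maximal⇒cycleThrough maxS (≤-reflexive ∣S∣≡h) (w∉q ∘ S⊆q)
    ... | q′ , cyc′ , q′⊆S , _ with IsCycle⇒OpenCycle G q′ cyc′
    ... | openCycle {x} {s} {y} path′ _ wx wy =
      outside⇒seesEnds path len w∉q wx wy x≢y
        (S⊆q (All.head q′⊆S)) (S⊆q (All.lookup q′⊆S (there y∈)))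
      where
      y∈ : y List.∈ s ∷ʳ y
      y∈ = ∈-++⁺ʳ s (here refl)
      x≢y : x ≢ y
      x≢y = All.lookup (AllPairs.head (proj₁ path′)) y∈

  SpecialPath⇒ICy : HasSpecialPath G h → IsICy G h
  SpecialPath⇒ICy (a , mid , b , path , len , sees-ends) =
    (S , maxS , ≤-antisym ∣S∣≤h (maximal⇒h≤∣∣ S maxS)) , maximal⇒h≤∣∣
    where
    p : List (Fin n)
    p = a ∷ mid ∷ʳ b
    S : Subset n
    S = fromList p

    ∣S∣≤h : ∣ S ∣ ≤ h
    ∣S∣≤h = subst (∣ S ∣ ≤_) len (∣fromList∣≤length p)

    maximal : ∀ T → S ⊆ T → CycleIndependent G T → T ⊆ S
    maximal T S⊆T T-independent {z} z∈T with z ∈? S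
    ... | yes z∈S = z∈S
    ... | no  z∉S =
      contradiction (z∈T ∷ All.tabulate (S⊆T ∘ ∈-fromList p)) (T-independent (z ∷ p) closed)
      where
      z∉p : ¬ (z List.∈ p)
      z∉p = z∉S ∘ ∈-fromList p
      closed : IsCycle G (z ∷ p)
      closed with sees-ends z z∉p
      ... | za , zb , _ = OpenCycle⇒IsCycle G (openCycle path z∉p za zb)

    maxS : MaximalCycleIndependent G S
    maxS = small⇒CycleIndependent S ∣S∣≤h , maximal

mainTheorem4 : ∀ {n : ℕ} (G : Graph n) → EveryVertexOnCycle G →
    ∀ (g : ℕ) → IsGirth G g →
    (IsICy G (g ∸ 1) ⇔ HasSpecialPath G (g ∸ 1))
mainTheorem4 G _ zero ((c , cyc , len) , _) =
  contradiction (subst (3 ≤_) len (IsCycle⇒3≤length G c cyc)) λ ()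
mainTheorem4 G _ (suc h) girth =
  mk⇔ (λ ((_ , maxS , ∣S∣≡h) , _) → maximal⇒SpecialPath maxS ∣S∣≡h) SpecialPath⇒ICy
  where open Girth G girth
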